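{- Let $\Lambda$ be a linear order, $\alpha\in|\Lambda|$, and $A,A_1,\dots,A_k\in\mathbb{W}_\alpha$. Then either $\mathsf{GLP}_\Lambda\vdash\langle\alpha\rangle(A\wedge\bigwedge_i\neg A_i)\leftrightarrow\langle\alpha\rangle A$, or $\mathsf{GLP}_\Lambda\vdash(A\wedge\bigwedge_i\neg A_i)\leftrightarrow\bot$ (and hence also $\mathsf{GLP}_\Lambda\vdash\langle\alpha\rangle(A\wedge\bigwedge_i\neg A_i)\leftrightarrow\bot$).
   Context: $\mathsf{GLP}_\Lambda$ is the modal logic with modalities $[\alpha]$, $\alpha\in|\Lambda|$, $\langle\alpha\rangle:=\neg[\alpha]\neg$, axiomatized by propositional tautologies and, for all $\alpha,\beta$: (i) $[\alpha](\chi\to\psi)\to([\alpha]\chi\to[\alpha]\psi)$; (ii) $[\alpha]([\alpha]\chi\to\chi)\to[\alpha]\chi$; (iii) $[\alpha]\chi\to[\beta][\alpha]\chi$ for $\alpha\le\beta$; (iv) $\langle\alpha\rangle\chi\to[\beta]\langle\alpha\rangle\chi$ for $\alpha<\beta$; (v) $[\alpha]\chi\to[\beta]\chi$ for $\alpha\le\beta$; with modus ponens and necessitation. A worm is a formula $\langle\alpha_1\rangle\cdots\langle\alpha_n\rangle\top$ ($n\ge0$); $\mathbb{W}_\alpha$ is the set of worms all of whose modals are $\ge\alpha$. -}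

module Defs where

open import Level using (Level)
open import Data.Nat using (ℕ)
open import Data.Bool using (Bool; true; false; not; _∧_)
open import Data.List using (List; []; _∷_)
open import Data.List.Relation.Unary.All using (All)
open import Relation.Binary.PropositionalEquality using (_≡_)
open import Relation.Binary.Bundles using (StrictTotalOrder)
open import Data.Sum using (_⊎_)

module GLP {c ℓ₁ ℓ₂ : Level} (Λ : StrictTotalOrder c ℓ₁ ℓ₂) where
  open StrictTotalOrder Λ renaming (Carrier to Ord)

  _≤_ : Ord → Ord → Set (ℓ₁ Level.⊔ ℓ₂)
  α ≤ β = (α < β) ⊎ (α ≈ β)

  data Fm : Set c where
    var : ℕ → Fm
    ⊥'  : Fm
    _⇒_ : Fm → Fm → Fm
    [_]_ : Ord → Fm → Fm

  infixr 5 _⇒_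
  infix 4 _⇔_
  infixr 6 _∧'_
  infix 8 [_]_ ⟨_⟩_

  ¬' : Fm → Fm
  ¬' φ = φ ⇒ ⊥'

  ⊤' : Fm
  ⊤' = ¬' ⊥'

  _∧'_ : Fm → Fm → Fm
  φ ∧' ψ = ¬' (φ ⇒ ¬' ψ)

  _⇔_ : Fm → Fm → Fm
  φ ⇔ ψ = (φ ⇒ ψ) ∧' (ψ ⇒ φ)

  ⟨_⟩_ : Ord → Fm → Fm
  ⟨ α ⟩ φ = ¬' ([ α ] ¬' φ)

  ⋀ : List Fm → Fm
  ⋀ []       = ⊤'
  ⋀ (φ ∷ φs) = φ ∧' ⋀ φs

  -- Propositional tautologies: true under every Boolean valuation in
  -- which variables and boxed formulas [α]φ are treated as atoms.
  eval : (ℕ → Bool) → (Ord → Fm → Bool) → Fm → Bool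
  eval v b (var n)   = v n
  eval v b ⊥'        = false
  eval v b (φ ⇒ ψ)   = not (eval v b φ) Data.Bool.∨ eval v b ψ
  eval v b ([ α ] φ) = b α φ

  Tautology : Fm → Set c
  Tautology φ = ∀ (v : ℕ → Bool) (b : Ord → Fm → Bool) → eval v b φ ≡ true

  data ⊢_ : Fm → Set (c Level.⊔ ℓ₁ Level.⊔ ℓ₂) where
    taut : ∀ {φ} → Tautology φ → ⊢ φ
    axK  : ∀ α χ ψ → ⊢ ([ α ] (χ ⇒ ψ) ⇒ ([ α ] χ ⇒ [ α ] ψ))
    axL  : ∀ α χ → ⊢ ([ α ] ([ α ] χ ⇒ χ) ⇒ [ α ] χ)
    ax3  : ∀ α β χ → α ≤ β → ⊢ ([ α ] χ ⇒ [ β ] ([ α ] χ))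
    ax4  : ∀ α β χ → α < β → ⊢ (⟨ α ⟩ χ ⇒ [ β ] (⟨ α ⟩ χ))
    ax5  : ∀ α β χ → α ≤ β → ⊢ ([ α ] χ ⇒ [ β ] χ)
    mp   : ∀ {φ ψ} → ⊢ (φ ⇒ ψ) → ⊢ φ → ⊢ ψ
    nec  : ∀ {φ} α → ⊢ φ → ⊢ ([ α ] φ)

  infix 2 ⊢_

  -- Worms ⟨α₁⟩⋯⟨αₙ⟩⊤, represented by the list [α₁,…,αₙ].
  Worm : Set c
  Worm = List Ord

  worm : Worm → Fm
  worm []       = ⊤'
  worm (α ∷ as) = ⟨ α ⟩ worm as

  InW : Ord → Worm → Set (c Level.⊔ ℓ₁ Level.⊔ ℓ₂)
  InW α w = All (λ β → α ≤ β) w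

module Submission where

-- Any two worms A, B ∈ 𝕎_α are comparable: B ⊢ ⟨α⟩A, or A ⊣⊢ B, or A ⊢ ⟨α⟩B. To see
-- this, split both worms at their least modality μ into the parts before and after the
-- first μ, and compare these parts recursively. The same recursion shows that for
-- A, B ∈ 𝕎_α either A ⊢ B or A ∧ B ⊢ ⟨α⟩A. If A entails some Aᵢ, the conjunction is
-- refutable; otherwise A ∧ [α]¬A entails every ¬Aᵢ, and Löb's ⟨α⟩A → ⟨α⟩(A ∧ [α]¬A)
-- gives the equivalence.

open import Defs
open import Level using (Level; _⊔_)
open import Data.Bool using (Bool; true; false; not; _∨_; _∧_; T)
open import Data.Bool.Properties using (T-≡; T-∧)
open import Data.Fin as Fin using (Fin)
open import Data.List using (List; []; _∷_; _++_; length; map)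
open import Data.List.Membership.Propositional using (_∈_)
open import Data.List.Properties using (length-++-≤ˡ; length-++-≤ʳ)
open import Data.List.Relation.Unary.All as All using (All; []; _∷_)
import Data.List.Relation.Unary.All.Properties as All
open import Data.List.Relation.Unary.Any as Any using (Any; here; there)
import Data.List.Relation.Unary.Any.Properties as Any
open import Data.Nat using (ℕ; zero; suc; _<_; _+_; s≤s; z≤n) renaming (_≤_ to _≤ℕ_)
open import Data.Nat.Induction using (<-wellFounded)
open import Data.Nat.Properties
  using (n<1+n; <-≤-trans; +-monoˡ-<; +-monoʳ-<; +-mono-<-≤; +-mono-≤-<)
open import Data.Product using (Σ-syntax; _×_; _,_; proj₁; proj₂)
open import Data.Sum as Sum using (_⊎_; inj₁; inj₂; [_,_]′)
open import Data.Vec as Vec using (Vec; []; _∷_; lookup)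
open import Data.Vec.Properties using (lookup-map)
open import Data.Empty using (⊥-elim)
open import Function using (_∘_; id; Equivalence)
open import Induction.WellFounded using (Acc; acc)
open import Relation.Binary.Bundles using (StrictTotalOrder)
open import Relation.Binary.PropositionalEquality using (_≡_; refl; sym; trans; cong₂)

any-or-all : ∀ {a p q} {X : Set a} {P : X → Set p} {Q : X → Set q} {xs : List X} →
             All (λ x → P x ⊎ Q x) xs → Any P xs ⊎ All Q xs
any-or-all []              = inj₂ []
any-or-all (inj₁ p ∷ _)    = inj₁ (here p)
any-or-all (inj₂ q ∷ pqs)  = Sum.map there (q ∷_) (any-or-all pqs)

module Worms {c ℓ₁ ℓ₂ : Level} (Λ : StrictTotalOrder c ℓ₁ ℓ₂) where
  open GLP Λ
  open StrictTotalOrder Λ using (_≈_; irrefl; <-respˡ-≈; module Eq)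
    renaming (Carrier to Ord; _<_ to _≺_)
  open import Relation.Binary.Properties.StrictTotalOrder Λ using (totalOrder; ≤-respˡ-≈)
  open import Data.List.Extrema totalOrder using (min; min≤⊤; min≤xs; argmin-sel)

  private variable
    ℓ : Level
    n : ℕ
    α β γ μ : Ord
    φ φ′ ψ ψ′ χ : Fm
    A B C h t : Worm
    L : Ord → Set ℓ

  -- Propositional schemes, instantiated by substitution and decided by truth tables.

  infixr 5 _⇒_
  infixr 6 _∧ˢ_

  data Scheme (n : ℕ) : Set where
    ‵_  : Fin n → Scheme n
    ⊥'  : Scheme n
    _⇒_ : Scheme n → Scheme n → Scheme n

  ¬ˢ_ : Scheme n → Scheme n
  ¬ˢ s = s ⇒ ⊥'

  _∧ˢ_ : Scheme n → Scheme n → Scheme n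
  s ∧ˢ s′ = ¬ˢ (s ⇒ ¬ˢ s′)

  p : Scheme (suc n)
  p = ‵ Fin.zero

  q : Scheme (suc (suc n))
  q = ‵ Fin.suc Fin.zero

  r : Scheme (suc (suc (suc n)))
  r = ‵ Fin.suc (Fin.suc Fin.zero)

  ⟦_⟧ : Scheme n → Vec Fm n → Fm
  ⟦ ‵ i ⟧    σ = lookup σ i
  ⟦ ⊥' ⟧     σ = ⊥'
  ⟦ s ⇒ s′ ⟧ σ = ⟦ s ⟧ σ ⇒ ⟦ s′ ⟧ σ

  truth : Vec Bool n → Scheme n → Bool
  truth ρ (‵ i)    = lookup ρ i
  truth ρ ⊥'       = false
  truth ρ (s ⇒ s′) = not (truth ρ s) ∨ truth ρ s′

  eval-⟦⟧ : ∀ v b (s : Scheme n) σ → eval v b (⟦ s ⟧ σ) ≡ truth (Vec.map (eval v b) σ) s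
  eval-⟦⟧ v b (‵ i)    σ = sym (lookup-map i (eval v b) σ)
  eval-⟦⟧ v b ⊥'       σ = refl
  eval-⟦⟧ v b (s ⇒ s′) σ = cong₂ (λ x y → not x ∨ y) (eval-⟦⟧ v b s σ) (eval-⟦⟧ v b s′ σ)

  every : (n : ℕ) → (Vec Bool n → Bool) → Bool
  every zero    f = f []
  every (suc n) f = every n (f ∘ (true ∷_)) ∧ every n (f ∘ (false ∷_))

  every-sound : ∀ n f → T (every n f) → (ρ : Vec Bool n) → T (f ρ)
  every-sound zero    f holds []          = holds
  every-sound (suc n) f holds (true ∷ ρ)  =
    every-sound n _ (proj₁ (Equivalence.to T-∧ holds)) ρ
  every-sound (suc n) f holds (false ∷ ρ) =
    every-sound n _ (proj₂ (Equivalence.to T-∧ holds)) ρ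

  Valid : Scheme n → Set
  Valid {n} s = T (every n (λ ρ → truth ρ s))

  -- The implicit validity proof is found by Agda: for a valid scheme it normalises to ⊤.
  tautology : (s : Scheme n) (σ : Vec Fm n) → {Valid s} → ⊢ ⟦ s ⟧ σ
  tautology s σ {valid} = taut λ v b →
    trans (eval-⟦⟧ v b s σ) (Equivalence.to T-≡ (every-sound _ _ valid (Vec.map (eval v b) σ)))

  infixr 4 _⨾_

  _⨾_ : ⊢ φ ⇒ ψ → ⊢ ψ ⇒ χ → ⊢ φ ⇒ χ
  _⨾_ {φ} {ψ} {χ} f g = mp (mp (tautology ((p ⇒ q) ⇒ (q ⇒ r) ⇒ (p ⇒ r)) (φ ∷ ψ ∷ χ ∷ [])) f) g

  ⇒-refl : ⊢ φ ⇒ φ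
  ⇒-refl {φ} = tautology (p ⇒ p) (φ ∷ [])


  ⊥-⇒ : ⊢ ⊥' ⇒ φ
  ⊥-⇒ {φ} = tautology (⊥' ⇒ p) (φ ∷ [])

  ⇒-const : ⊢ ψ → ⊢ φ ⇒ ψ
  ⇒-const {ψ} {φ} = mp (tautology (p ⇒ q ⇒ p) (ψ ∷ φ ∷ []))

  ⊤-intro : ⊢ ⊤'
  ⊤-intro = tautology (¬ˢ ⊥') []

  ⇒-⊤ : ⊢ φ ⇒ ⊤'
  ⇒-⊤ = ⇒-const ⊤-intro

  contrapose : ⊢ φ ⇒ ψ → ⊢ ¬' ψ ⇒ ¬' φ
  contrapose {φ} {ψ} = mp (tautology ((p ⇒ q) ⇒ (¬ˢ q ⇒ ¬ˢ p)) (φ ∷ ψ ∷ []))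

  ¬¬-intro : ⊢ φ ⇒ ¬' (¬' φ)
  ¬¬-intro {φ} = tautology (p ⇒ ¬ˢ ¬ˢ p) (φ ∷ [])

  ∧-intro : ⊢ φ ⇒ ψ → ⊢ φ ⇒ χ → ⊢ φ ⇒ ψ ∧' χ
  ∧-intro {φ} {ψ} {χ} f g =
    mp (mp (tautology ((p ⇒ q) ⇒ (p ⇒ r) ⇒ (p ⇒ q ∧ˢ r)) (φ ∷ ψ ∷ χ ∷ [])) f) g

  ∧-elimˡ : ⊢ φ ∧' ψ ⇒ φ
  ∧-elimˡ {φ} {ψ} = tautology (p ∧ˢ q ⇒ p) (φ ∷ ψ ∷ [])

  ∧-elimʳ : ⊢ φ ∧' ψ ⇒ ψ
  ∧-elimʳ {φ} {ψ} = tautology (p ∧ˢ q ⇒ q) (φ ∷ ψ ∷ [])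

  ∧-mono : ⊢ φ ⇒ φ′ → ⊢ ψ ⇒ ψ′ → ⊢ φ ∧' ψ ⇒ φ′ ∧' ψ′
  ∧-mono f g = ∧-intro (∧-elimˡ ⨾ f) (∧-elimʳ ⨾ g)

  ∧-refute : ⊢ ψ ⇒ ¬' φ → ⊢ φ ∧' ψ ⇒ ⊥'
  ∧-refute {ψ} {φ} = mp (tautology ((q ⇒ ¬ˢ p) ⇒ (p ∧ˢ q ⇒ ⊥')) (φ ∷ ψ ∷ []))

  ∧-exchange-¬ : ⊢ φ ∧' ψ ⇒ ¬' χ → ⊢ φ ∧' χ ⇒ ¬' ψ
  ∧-exchange-¬ {φ} {ψ} {χ} = mp (tautology ((p ∧ˢ q ⇒ ¬ˢ r) ⇒ (p ∧ˢ r ⇒ ¬ˢ q)) (φ ∷ ψ ∷ χ ∷ []))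

  ⇔-intro : ⊢ φ ⇒ ψ → ⊢ ψ ⇒ φ → ⊢ φ ⇔ ψ
  ⇔-intro {φ} {ψ} f g = mp (mp (tautology (p ⇒ q ⇒ p ∧ˢ q) ((φ ⇒ ψ) ∷ (ψ ⇒ φ) ∷ [])) f) g

  ⋀-intro : {ψs : List Fm} → All (λ ψ → ⊢ φ ⇒ ψ) ψs → ⊢ φ ⇒ ⋀ ψs
  ⋀-intro []       = ⇒-⊤
  ⋀-intro (f ∷ fs) = ∧-intro f (⋀-intro fs)

  ⋀-elim : {ψs : List Fm} → Any (λ ψ → ⊢ ψ ⇒ χ) ψs → ⊢ ⋀ ψs ⇒ χ
  ⋀-elim (here f)  = ∧-elimˡ ⨾ f
  ⋀-elim (there f) = ∧-elimʳ ⨾ ⋀-elim f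

  ≤-refl : α ≤ α
  ≤-refl = inj₂ Eq.refl

  □-mono : ⊢ φ ⇒ ψ → ⊢ [ α ] φ ⇒ [ α ] ψ
  □-mono {φ} {ψ} {α} f = mp (axK α φ ψ) (nec α f)

  ◇-mono : ⊢ φ ⇒ ψ → ⊢ ⟨ α ⟩ φ ⇒ ⟨ α ⟩ ψ
  ◇-mono f = contrapose (□-mono (contrapose f))

  ◇-antitone : α ≤ β → ⊢ ⟨ β ⟩ φ ⇒ ⟨ α ⟩ φ
  ◇-antitone {α} {β} {φ} α≤β = contrapose (ax5 α β (¬' φ) α≤β)

  ◇◇⇒◇ : α ≤ β → α ≤ γ → ⊢ ⟨ β ⟩ ⟨ γ ⟩ φ ⇒ ⟨ α ⟩ φ
  ◇◇⇒◇ {α} {φ = φ} α≤β α≤γ =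
    ◇-antitone α≤β ⨾ ◇-mono (◇-antitone α≤γ) ⨾ contrapose (ax3 α α (¬' φ) ≤-refl ⨾ □-mono ¬¬-intro)

  ◇-∧-persistent : ⊢ ψ ⇒ [ γ ] ψ → ⊢ ⟨ γ ⟩ φ ∧' ψ ⇒ ⟨ γ ⟩ (φ ∧' ψ)
  ◇-∧-persistent {ψ} {γ} {φ} ψ⇒□ψ =
    mp (tautology ((r ⇒ p ⇒ q) ⇒ (¬ˢ q ∧ˢ r ⇒ ¬ˢ p)) ([ γ ] ¬' (φ ∧' ψ) ∷ [ γ ] ¬' φ ∷ ψ ∷ []))
       (ψ⇒□ψ ⨾ □-mono (tautology (q ⇒ ¬ˢ (p ∧ˢ q) ⇒ ¬ˢ p) (φ ∷ ψ ∷ []))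
             ⨾ axK γ (¬' (φ ∧' ψ)) (¬' φ))

  ◇-löb : ⊢ ⟨ α ⟩ φ ⇒ ⟨ α ⟩ (φ ∧' [ α ] ¬' φ)
  ◇-löb {α} {φ} =
    contrapose (□-mono (tautology (¬ˢ (p ∧ˢ q) ⇒ q ⇒ ¬ˢ p) (φ ∷ [ α ] ¬' φ ∷ [])) ⨾ axL α (¬' φ))

  worm-++⇒ˡ : ∀ h w → ⊢ worm (h ++ w) ⇒ worm h
  worm-++⇒ˡ []      w = ⇒-⊤
  worm-++⇒ˡ (a ∷ h) w = ◇-mono (worm-++⇒ˡ h w)

  worm-++⇒ʳ : ∀ w → All (λ a → ⊢ ⟨ a ⟩ worm w ⇒ worm w) h → ⊢ worm (h ++ w) ⇒ worm w
  worm-++⇒ʳ w []              = ⇒-refl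
  worm-++⇒ʳ w (absorbs ∷ hs) = ◇-mono (worm-++⇒ʳ w hs) ⨾ absorbs

  worm-∧⇒++ : ∀ w → All (λ a → ⊢ worm w ⇒ [ a ] worm w) h → ⊢ worm h ∧' worm w ⇒ worm (h ++ w)
  worm-∧⇒++ w []               = ∧-elimʳ
  worm-∧⇒++ w (persists ∷ hs) = ◇-∧-persistent persists ⨾ ◇-mono (worm-∧⇒++ w hs)

  -- A worm in 𝕎_μ splits at its first μ as h ++ t, where h ∈ 𝕎_{>μ} and t is either
  -- empty or ⟨μ⟩ r with r ∈ 𝕎_μ.

  data Tail (μ : Ord) : Worm → Set (c ⊔ ℓ₁ ⊔ ℓ₂) where
    none : Tail μ []
    at   : ∀ {a r} → μ ≈ a → All (μ ≤_) r → Tail μ (a ∷ r)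

  tail-absorbs : Tail μ t → μ ≤ γ → ⊢ ⟨ γ ⟩ worm t ⇒ worm t
  tail-absorbs none         _   = ⇒-⊤
  tail-absorbs (at μ≈a _) μ≤γ = ◇◇⇒◇ (≤-respˡ-≈ μ≈a μ≤γ) ≤-refl

  tail-persistent : Tail μ t → μ ≺ γ → ⊢ worm t ⇒ [ γ ] worm t
  tail-persistent {γ = γ} none _ = ⇒-const (nec γ ⊤-intro)
  tail-persistent {γ = γ} (at {a} μ≈a _) μ≺γ = ax4 a γ _ (<-respˡ-≈ μ≈a μ≺γ)

  tail-lower : Tail μ t → All (μ ≤_) t
  tail-lower none          = []
  tail-lower (at μ≈a μ≤r) = inj₂ μ≈a ∷ μ≤r

  data Split (μ : Ord) : Worm → Set (c ⊔ ℓ₁ ⊔ ℓ₂) where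
    split : All (μ ≺_) h → Tail μ t → Split μ (h ++ t)

  split-at : All (μ ≤_) A → Split μ A
  split-at []              = split [] none
  split-at (inj₂ μ≈a ∷ μ≤A) = split [] (at μ≈a μ≤A)
  split-at (inj₁ μ≺a ∷ μ≤A) with split-at μ≤A
  ... | split μ≺h T = split (μ≺a ∷ μ≺h) T

  prefix suffix : Split μ A → Worm
  prefix (split {h} _ _) = h
  suffix (split {t = t} _ _) = t

  prefix-above : (s : Split μ A) → All (μ ≺_) (prefix s)
  prefix-above (split μ≺h _) = μ≺h

  split-lower : Split μ A → All (μ ≤_) A
  split-lower (split μ≺h T) = All.++⁺ (All.map inj₁ μ≺h) (tail-lower T)

  split-prefix : (s : Split μ A) → ⊢ worm A ⇒ worm (prefix s)
  split-prefix (split {h} {t} _ _) = worm-++⇒ˡ h t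

  split-suffix : (s : Split μ A) → ⊢ worm A ⇒ worm (suffix s)
  split-suffix (split {t = t} μ≺h T) = worm-++⇒ʳ t (All.map (λ μ≺a → tail-absorbs T (inj₁ μ≺a)) μ≺h)

  join : (s : Split μ A) → ⊢ φ ⇒ worm (prefix s) → ⊢ φ ⇒ worm (suffix s) → ⊢ φ ⇒ worm A
  join (split {t = t} μ≺h T) f g = ∧-intro f g ⨾ worm-∧⇒++ t (All.map (tail-persistent T) μ≺h)

  join◇ : (s : Split μ A) → μ ≺ γ →
          ⊢ φ ⇒ ⟨ γ ⟩ worm (prefix s) → ⊢ φ ⇒ worm (suffix s) → ⊢ φ ⇒ ⟨ γ ⟩ worm A
  join◇ (split {t = t} μ≺h T) μ≺γ f g =
    ∧-intro f g ⨾ worm-∧⇒++ t (All.map (tail-persistent T) (μ≺γ ∷ μ≺h))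

  prefix-≤ : (s : Split μ A) → length (prefix s) ≤ℕ length A
  prefix-≤ (split {h} _ _) = length-++-≤ˡ h

  suffix-≤ : (s : Split μ A) → length (suffix s) ≤ℕ length A
  suffix-≤ (split {h} {t} _ _) = length-++-≤ʳ t {h}

  prefix-< : (s : Split μ A) → μ ∈ A → length (prefix s) < length A
  prefix-< (split μ≺h _) = shorter μ≺h
    where
    shorter : All (μ ≺_) h → μ ∈ h ++ t → length h < length (h ++ t)
    shorter {t = _ ∷ _} []          _          = s≤s z≤n
    shorter             (μ≺a ∷ _)   (here refl) = ⊥-elim (irrefl Eq.refl μ≺a)
    shorter             (_ ∷ μ≺h)   (there μ∈) = s≤s (shorter μ≺h μ∈)

  infix 4 _≻[_]_
  infixr 4 _⨾≻_

  -- The level is only constrained by a predicate L, so that one recursion serves both the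
  -- bound α ≤ _ and the strict bound μ < _ on the parts above μ.
  _≻[_]_ : Fm → (Ord → Set ℓ) → Fm → Set (c ⊔ ℓ ⊔ ℓ₁ ⊔ ℓ₂)
  φ ≻[ L ] ψ = Σ[ γ ∈ Ord ] L γ × (⊢ φ ⇒ ⟨ γ ⟩ ψ)

  _⨾≻_ : ⊢ φ ⇒ ψ → ψ ≻[ L ] χ → φ ≻[ L ] χ
  f ⨾≻ (γ , Lγ , g) = γ , Lγ , f ⨾ g

  ≻-at : L μ → φ ≻[ μ ≤_ ] ψ → φ ≻[ L ] ψ
  ≻-at {μ = μ} Lμ (γ , μ≤γ , f) = μ , Lμ , f ⨾ ◇-antitone μ≤γ

  data Comparison (L : Ord → Set ℓ) (A B : Worm) : Set (c ⊔ ℓ ⊔ ℓ₁ ⊔ ℓ₂) where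
    less       : worm B ≻[ L ] worm A → Comparison L A B
    equivalent : ⊢ worm A ⇒ worm B → ⊢ worm B ⇒ worm A → Comparison L A B
    greater    : worm A ≻[ L ] worm B → Comparison L A B

  swap : Comparison L A B → Comparison L B A
  swap (less B≻A)         = greater B≻A
  swap (equivalent f g)   = equivalent g f
  swap (greater A≻B)      = less A≻B

  comparison-at : L μ → Comparison (μ ≤_) A B → Comparison L A B
  comparison-at Lμ (less B≻A)       = less (≻-at Lμ B≻A)
  comparison-at Lμ (equivalent f g) = equivalent f g
  comparison-at Lμ (greater A≻B)    = greater (≻-at Lμ A≻B)

  size : Worm → Worm → ℕ
  size A B = length A + length B

  -- μ is a lower bound of A and B occurring in one of them, e.g. their least modality.
  data Pivoting (L : Ord → Set ℓ) : Worm → Worm → Set (c ⊔ ℓ ⊔ ℓ₁ ⊔ ℓ₂) where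
    empty : Pivoting L [] []
    pivot : L μ → (sA : Split μ A) (sB : Split μ B) →
            size (prefix sA) (prefix sB) < size A B → Pivoting L A B

  lowest : ∀ x xs → Σ[ μ ∈ Ord ] μ ∈ x ∷ xs × All (μ ≤_) (x ∷ xs)
  lowest x xs = min x xs , [ here , there ]′ (argmin-sel id x xs) , min≤⊤ x xs ∷ min≤xs x xs

  heads-shorter : (sA : Split μ A) (sB : Split μ B) → μ ∈ A ⊎ μ ∈ B →
                  size (prefix sA) (prefix sB) < size A B
  heads-shorter sA sB (inj₁ μ∈A) = +-mono-<-≤ (prefix-< sA μ∈A) (prefix-≤ sB)
  heads-shorter sA sB (inj₂ μ∈B) = +-mono-≤-< (prefix-≤ sA) (prefix-< sB μ∈B)

  pivot-at : Σ[ μ ∈ Ord ] μ ∈ A ++ B × All (μ ≤_) (A ++ B) → All L A → All L B → Pivoting L A B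
  pivot-at {A = A} (μ , μ∈ , μ≤) LA LB =
    pivot (All.lookup (All.++⁺ LA LB) μ∈) sA sB (heads-shorter sA sB (Any.++⁻ A μ∈))
    where
    sA = split-at (All.++⁻ˡ A μ≤)
    sB = split-at (All.++⁻ʳ A μ≤)

  pivoting : All L A → All L B → Pivoting L A B
  pivoting {A = []}    {B = []}    _  _  = empty
  pivoting {A = a ∷ A} {B = B}     LA LB = pivot-at (lowest a (A ++ B)) LA LB
  pivoting {A = []}    {B = b ∷ B} LA LB = pivot-at (lowest b B) LA LB

  tail-or-below : (sA : Split μ A) →
                  (∀ {r} → length r < length (suffix sA) → All (μ ≤_) r → Comparison (μ ≤_) r C) →
                  (⊢ worm C ⇒ worm (suffix sA)) ⊎ (worm A ≻[ μ ≤_ ] worm C)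
  tail-or-below (split _ none) _ = inj₁ ⇒-⊤
  tail-or-below {μ = μ} sA@(split {t = a ∷ r} _ (at μ≈a μ≤r)) compare-r with compare-r (n<1+n _) μ≤r
  ... | less (γ , μ≤γ , C⇒◇r)    = inj₁ (C⇒◇r ⨾ ◇-antitone (≤-respˡ-≈ μ≈a μ≤γ))
  ... | equivalent r⇒C _          = inj₂ (a , inj₂ μ≈a , split-suffix sA ⨾ ◇-mono r⇒C)
  ... | greater (γ , μ≤γ , r⇒◇C) =
    inj₂ (μ , ≤-refl , split-suffix sA ⨾ ◇-mono r⇒◇C ⨾ ◇◇⇒◇ (inj₂ μ≈a) μ≤γ)

  mutual
    compare-acc : (L : Ord → Set ℓ) → All L A → All L B → Acc _<_ (size A B) → Comparison L A B
    compare-acc L LA LB accessible with pivoting LA LB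
    ... | empty                       = equivalent ⇒-refl ⇒-refl
    ... | pivot Lμ sA sB heads-shrink =
      comparison-at Lμ (compare-split sA sB heads-shrink accessible)

    compare-split : (sA : Split μ A) (sB : Split μ B) → size (prefix sA) (prefix sB) < size A B →
                    Acc _<_ (size A B) → Comparison (μ ≤_) A B
    compare-split {μ} {A} {B} sA sB heads-shrink (acc rec)
      with tail-or-below sA (λ r< μ≤r → compare-acc (μ ≤_) μ≤r (split-lower sB)
                               (rec (+-monoˡ-< (length B) (<-≤-trans r< (suffix-≤ sA)))))
         | tail-or-below sB (λ r< μ≤r → swap (compare-acc (μ ≤_) (split-lower sA) μ≤r
                               (rec (+-monoʳ-< (length A) (<-≤-trans r< (suffix-≤ sB))))))
    ... | inj₂ A≻B | _        = greater A≻B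
    ... | inj₁ _   | inj₂ B≻A = less B≻A
    ... | inj₁ B⇒tA | inj₁ A⇒tB
      with compare-acc (μ ≺_) (prefix-above sA) (prefix-above sB) (rec heads-shrink)
    ... | less (γ , μ≺γ , hB⇒◇hA) =
      less (γ , inj₁ μ≺γ , join◇ sA μ≺γ (split-prefix sB ⨾ hB⇒◇hA) B⇒tA)
    ... | equivalent hA⇒hB hB⇒hA =
      equivalent (join sB (split-prefix sA ⨾ hA⇒hB) A⇒tB) (join sA (split-prefix sB ⨾ hB⇒hA) B⇒tA)
    ... | greater (γ , μ≺γ , hA⇒◇hB) =
      greater (γ , inj₁ μ≺γ , join◇ sB μ≺γ (split-prefix sA ⨾ hA⇒◇hB) A⇒tB)

  compare : All L A → All L B → Comparison L A B
  compare LA LB = compare-acc _ LA LB (<-wellFounded _)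

  entails-or-reflects-acc : All L A → All L B → Acc _<_ (size A B) →
                            (⊢ worm A ⇒ worm B) ⊎ (worm A ∧' worm B ≻[ L ] worm A)
  entails-or-reflects-acc LA LB (acc rec) with pivoting LA LB
  ... | empty = inj₁ ⇒-refl
  ... | pivot {μ} Lμ sA sB heads-shrink
    with tail-or-below sB (λ _ μ≤r → compare μ≤r (split-lower sA))
  ... | inj₂ B≻A = inj₂ (≻-at Lμ (∧-elimʳ ⨾≻ B≻A))
  ... | inj₁ A⇒tB
    with entails-or-reflects-acc (prefix-above sA) (prefix-above sB) (rec heads-shrink)
  ... | inj₁ hA⇒hB = inj₁ (join sB (split-prefix sA ⨾ hA⇒hB) A⇒tB)
  ... | inj₂ (γ , μ≺γ , hA∧hB⇒◇hA) =
    inj₂ (μ , Lμ , join◇ sA μ≺γ (∧-mono (split-prefix sA) (split-prefix sB) ⨾ hA∧hB⇒◇hA)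
                                 (∧-elimˡ ⨾ split-suffix sA)
                   ⨾ ◇-antitone (inj₁ μ≺γ))

  entails-or-reflects : InW α A → InW α B →
                        (⊢ worm A ⇒ worm B) ⊎ (⊢ worm A ∧' worm B ⇒ ⟨ α ⟩ worm A)
  entails-or-reflects A∈𝕎 B∈𝕎 =
    Sum.map₂ (λ (_ , α≤γ , f) → f ⨾ ◇-antitone α≤γ)
             (entails-or-reflects-acc A∈𝕎 B∈𝕎 (<-wellFounded _))

  negations : List Worm → Fm
  negations As = ⋀ (map (λ B → ¬' (worm B)) As)

  refute : {As : List Worm} → Any (λ B → ⊢ worm A ⇒ worm B) As → ⊢ worm A ∧' negations As ⇒ ⊥'
  refute entailed = ∧-refute (⋀-elim (Any.map⁺ (Any.map contrapose entailed)))

  reflect : {As : List Worm} → All (λ B → ⊢ worm A ∧' worm B ⇒ ⟨ α ⟩ worm A) As →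
            ⊢ worm A ∧' [ α ] ¬' (worm A) ⇒ negations As
  reflect reflected = ⋀-intro (All.map⁺ (All.map ∧-exchange-¬ reflected))

mainTheorem17 : ∀ {c ℓ₁ ℓ₂ : Level} (Λ : StrictTotalOrder c ℓ₁ ℓ₂) →
    let open GLP Λ in
    (α : StrictTotalOrder.Carrier Λ) (A : Worm) (As : List Worm) →
    InW α A → All (InW α) As →
    (⊢ (⟨ α ⟩ (worm A ∧' ⋀ (map (λ B → ¬' (worm B)) As)) ⇔ (⟨ α ⟩ (worm A))))
    ⊎ (⊢ ((worm A ∧' ⋀ (map (λ B → ¬' (worm B)) As)) ⇔ ⊥'))
mainTheorem17 Λ α A As A∈𝕎 As∈𝕎 =
  let open GLP Λ; open Worms Λ in
  [ (λ entailed → inj₂ (⇔-intro (refute entailed) ⊥-⇒))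
  , (λ reflected → inj₁ (⇔-intro (◇-mono ∧-elimˡ)
                                  (◇-löb ⨾ ◇-mono (∧-intro ∧-elimˡ (reflect reflected)))))
  ]′ (any-or-all (All.map (entails-or-reflects A∈𝕎) As∈𝕎))
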